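{- Let $G$ be a connected graph of order $r\ge 2$. Let $H$ be a graph of order $t\ge 2$ and let $v$ be a vertex of $H$ of degree $t-1$. (i) If $H-v$ has diameter two, then $\dim_s(G\circ_v H)=(r-1)(t-1)+\dim_s(H-v)$. (ii) If $H-v$ has diameter greater than two, then $\dim_s(G\circ_v H)=(r-1)(t-1)+\dim_s(H)$.
   Context: All graphs are finite and simple; $d$ denotes shortest-path distance. A vertex $w$ strongly resolves $u,x$ if $d(w,u)=d(w,x)+d(x,u)$ or $d(w,x)=d(w,u)+d(u,x)$. A strong metric generator of a connected graph $X$ is a set of vertices $S$ such that every pair of vertices is strongly resolved by some vertex of $S$; $\dim_s(X)$ is the minimum cardinality of such a set. Rooted product: for a graph $G$ with $V(G)=\{u_1,\dots,u_n\}$ and a graph $H$ with root $v$, $G\circ_v H$ has vertex set $V(G)\times V(H)$ and edge set $\bigcup_{i=1}^n\{(u_i,b)(u_i,y): by\in E(H)\}\cup\{(u_i,v)(u_j,v): u_iu_j\in E(G)\}$. $H-v$ is the graph obtained from $H$ by deleting $v$; its diameter is the maximum distance between two of its vertices. -}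

module Defs where

open import Data.Nat using (ℕ; zero; suc; _+_; _*_; _≤_; _<_)
open import Data.Bool using (Bool; true; false; _∧_; _∨_)
open import Data.Bool.Properties using (∨-comm)
open import Data.Fin using (Fin; punchIn; remQuot)
open import Data.Fin.Properties using (_≟_)
open import Data.Fin.Subset using (Subset; _∈_; ∣_∣)
open import Data.Vec using (tabulate)
open import Data.Product using (Σ; ∃; ∃-syntax; _×_; _,_; proj₁; proj₂)
open import Data.Sum using (_⊎_)
open import Relation.Nullary using (¬_; does; yes; no)
open import Relation.Binary.PropositionalEquality using (_≡_; _≢_; refl; sym; cong; cong₂)

record Graph (n : ℕ) : Set where
  field
    adj    : Fin n → Fin n → Bool
    adjSym : ∀ i j → adj i j ≡ adj j i
    adjIrr : ∀ i → adj i i ≡ false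
open Graph public

degree : ∀ {n} → Graph n → Fin n → ℕ
degree G u = ∣ tabulate (adj G u) ∣

data Walk {n} (G : Graph n) : Fin n → Fin n → ℕ → Set where
  here : ∀ {u} → Walk G u u 0
  step : ∀ {u w x k} → adj G u w ≡ true → Walk G w x k → Walk G u x (suc k)

Dist : ∀ {n} → Graph n → Fin n → Fin n → ℕ → Set
Dist G u x k = Walk G u x k × (∀ m → m < k → ¬ Walk G u x m)

Connected : ∀ {n} → Graph n → Set
Connected G = ∀ u x → ∃[ k ] Walk G u x k

StronglyResolves : ∀ {n} → Graph n → Fin n → Fin n → Fin n → Set
StronglyResolves G w u x =
  (∃[ a ] ∃[ b ] ∃[ c ] (Dist G w u a × Dist G w x b × Dist G x u c × a ≡ b + c))
  ⊎ (∃[ a ] ∃[ b ] ∃[ c ] (Dist G w x a × Dist G w u b × Dist G u x c × a ≡ b + c))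

IsStrongMetricGenerator : ∀ {n} → Graph n → Subset n → Set
IsStrongMetricGenerator G S =
  ∀ u x → u ≢ x → ∃[ w ] (w ∈ S × StronglyResolves G w u x)

IsStrongMetricDim : ∀ {n} → Graph n → ℕ → Set
IsStrongMetricDim G k =
  (∃[ S ] (IsStrongMetricGenerator G S × ∣ S ∣ ≡ k))
  × (∀ S → IsStrongMetricGenerator G S → k ≤ ∣ S ∣)

HasDiameter : ∀ {n} → Graph n → ℕ → Set
HasDiameter G d =
  (∀ u x → ∃[ k ] (k ≤ d × Dist G u x k)) × (∃[ u ] ∃[ x ] Dist G u x d)

DiameterAtMost : ∀ {n} → Graph n → ℕ → Set
DiameterAtMost G d = ∀ u x → ∃[ k ] (k ≤ d × Walk G u x k)

-- H - v, vertices of H - v are indexed via punchIn v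
deleteVertex : ∀ {m} → Graph (suc m) → Fin (suc m) → Graph m
deleteVertex H v = record
  { adj    = λ i j → adj H (punchIn v i) (punchIn v j)
  ; adjSym = λ i j → adjSym H (punchIn v i) (punchIn v j)
  ; adjIrr = λ i → adjIrr H (punchIn v i)
  }

_==_ : ∀ {n} → Fin n → Fin n → Bool
i == j = does (i ≟ j)

==-sym : ∀ {n} (i j : Fin n) → (i == j) ≡ (j == i)
==-sym i j with i ≟ j | j ≟ i
... | yes _ | yes _ = refl
... | no _  | no _  = refl
... | yes p | no q  with q (sym p)
... | ()
==-sym i j | no p | yes q with p (sym q)
... | ()

==-refl : ∀ {n} (i : Fin n) → (i == i) ≡ true
==-refl i with i ≟ i
... | yes _ = refl
... | no p with p refl
... | ()

rpAdj : ∀ {r t} → Graph r → Fin t → Graph t → Fin r → Fin t → Fin r → Fin t → Bool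
rpAdj G v H i b j y = ((i == j) ∧ adj H b y) ∨ (((b == v) ∧ (y == v)) ∧ adj G i j)

private
  ∧-comm' : ∀ a b → (a ∧ b) ≡ (b ∧ a)
  ∧-comm' false false = refl
  ∧-comm' false true  = refl
  ∧-comm' true  false = refl
  ∧-comm' true  true  = refl

  ∧-false : ∀ a → (a ∧ false) ≡ false
  ∧-false false = refl
  ∧-false true  = refl

rpAdjSym : ∀ {r t} (G : Graph r) (v : Fin t) (H : Graph t) i b j y →
           rpAdj G v H i b j y ≡ rpAdj G v H j y i b
rpAdjSym G v H i b j y =
  cong₂ _∨_ (cong₂ _∧_ (==-sym i j) (adjSym H b y))
            (cong₂ _∧_ (∧-comm' (b == v) (y == v)) (adjSym G i j))

rpAdjIrr : ∀ {r t} (G : Graph r) (v : Fin t) (H : Graph t) i b →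
           rpAdj G v H i b i b ≡ false
rpAdjIrr G v H i b
  rewrite ==-refl i | adjIrr H b | adjIrr G i | ∧-false ((b == v) ∧ (b == v)) = refl

-- The rooted product G ∘_v H; vertex (u_i , b) is the element of
-- Fin (r * t) sent to (i , b) by remQuot t.
rpFst : ∀ r t → Fin (r * t) → Fin r
rpFst r t p = proj₁ (remQuot {r} t p)

rpSnd : ∀ r t → Fin (r * t) → Fin t
rpSnd r t p = proj₂ (remQuot {r} t p)

rootedProduct : ∀ {r t} → Graph r → Fin t → Graph t → Graph (r * t)
rootedProduct {r} {t} G v H = record
  { adj    = λ p q → rpAdj G v H (rpFst r t p) (rpSnd r t p) (rpFst r t q) (rpSnd r t q)
  ; adjSym = λ p q → rpAdjSym G v H (rpFst r t p) (rpSnd r t p) (rpFst r t q) (rpSnd r t q)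
  ; adjIrr = λ p → rpAdjIrr G v H (rpFst r t p) (rpSnd r t p)
  }

module Submission where

-- Call the vertices of H other than v its leaves, and a set of vertices
-- of H leaf-resolving if it strongly resolves every pair of leaves.  Both
-- parts of the theorem follow from one statement: if the smallest
-- leaf-resolving sets have k elements, then dim_s(X) = (r - 1)(t - 1) + k.
--   Lower bound: the resolver of two leaves in different copies of H must
--   be one of them, so all copies but one contain all their leaves; two
--   leaves of one copy are only resolved from inside that copy, so the
--   remaining copy contains a leaf-resolving set.
--   Upper bound: all leaves of r - 1 copies together with a leaf-resolving
--   set in the last copy strongly resolve X.
-- The smallest leaf-resolving sets have dim_s(H - v) elements when H - v
-- has diameter two (distances in H - v and in H then agree), and dim_s(H)
-- elements otherwise (a leaf-resolving set then also resolves v from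
-- every leaf, unless some leaf dominates H - v).

open import Defs
open import Data.Nat using (ℕ; zero; suc; _+_; _*_; _∸_; _≤_; _<_; z≤n; s≤s; s≤s⁻¹)
open import Data.Nat.Properties
open import Data.Nat.Tactic.RingSolver using (solve-∀)
open import Data.Bool using (Bool; true; false; if_then_else_; not; _∧_; _∨_)
open import Data.Bool.Properties using (∨-zeroʳ) renaming (_≟_ to _≟ᵇ_)
open import Data.Fin using (Fin; zero; suc; punchIn; punchOut; _↑ˡ_; _↑ʳ_; combine; remQuot)
open import Data.Fin.Properties using (any?; punchIn-injective; punchIn-punchOut; punchInᵢ≢i; remQuot-combine; combine-remQuot) renaming (_≟_ to _≟ᶠ_)
open import Data.Fin.Subset using (Subset; ∣_∣; ⊤)
open import Data.Fin.Subset.Properties using (∣p∣≡n⇒p≡⊤)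
open import Data.Vec using (lookup; tabulate; insertAt)
open import Data.Vec.Properties using (insertAt-lookup; insertAt-punchIn; lookup∘tabulate; tabulate∘lookup; lookup-replicate; []=⇒lookup; lookup⇒[]=)
open import Data.Product using (∃-syntax; _×_; _,_; proj₁; proj₂)
open import Data.Sum using (_⊎_; inj₁; inj₂)
open import Data.Empty using (⊥-elim)
open import Function using (_∘_; id; _⇔_; mk⇔; Equivalence)
open import Relation.Nullary using (¬_; ¬?; Dec; yes; no; _×-dec_)
open import Relation.Nullary.Decidable using (dec-false)
open import Relation.Binary.PropositionalEquality
open import Algebra.Properties.CommutativeMonoid.Sum +-0-commutativeMonoid
  using (sum; sum-remove; sum-cong-≗)

open Equivalence using (to; from)

sum-const : ∀ n c → sum {n} (λ _ → c) ≡ n * c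
sum-const zero    c = refl
sum-const (suc n) c = cong (c +_) (sum-const n c)

sum-mono : ∀ {n} {f g : Fin n → ℕ} → (∀ i → f i ≤ g i) → sum f ≤ sum g
sum-mono {zero}  f≤g = z≤n
sum-mono {suc n} f≤g = +-mono-≤ (f≤g zero) (sum-mono (f≤g ∘ suc))

sum-++ : ∀ a {b} (f : Fin (a + b) → ℕ) → sum f ≡ sum (f ∘ (_↑ˡ b)) + sum (f ∘ (a ↑ʳ_))
sum-++ zero    f = refl
sum-++ (suc a) f = trans (cong (f zero +_) (sum-++ a (f ∘ suc))) (sym (+-assoc (f zero) _ _))

sum-combine : ∀ r {t} (f : Fin (r * t) → ℕ) →
              sum f ≡ sum {r} (λ i → sum {t} (λ b → f (combine i b)))
sum-combine zero    f = refl
sum-combine (suc r) {t} f =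
  trans (sum-++ t f) (cong (sum (f ∘ (_↑ˡ (r * t))) +_) (sum-combine r (f ∘ (t ↑ʳ_))))

indicator : Bool → ℕ
indicator b = if b then 1 else 0

count : ∀ {n} → (Fin n → Bool) → ℕ
count f = sum (indicator ∘ f)

count-tabulate : ∀ {n} (f : Fin n → Bool) → ∣ tabulate f ∣ ≡ count f
count-tabulate {zero}  f = refl
count-tabulate {suc n} f with f zero
... | true  = cong suc (count-tabulate (f ∘ suc))
... | false = count-tabulate (f ∘ suc)

count-lookup : ∀ {n} (S : Subset n) → ∣ S ∣ ≡ count (lookup S)
count-lookup S = trans (cong ∣_∣ (sym (tabulate∘lookup S))) (count-tabulate (lookup S))

count-remove : ∀ {n} (i : Fin (suc n)) (f : Fin (suc n) → Bool) →
               count f ≡ indicator (f i) + count (f ∘ punchIn i)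
count-remove i f = sum-remove {i = i} (indicator ∘ f)

count-cong : ∀ {n} {f g : Fin n → Bool} → (∀ i → f i ≡ g i) → count f ≡ count g
count-cong f≗g = sum-cong-≗ (cong indicator ∘ f≗g)

count-full : ∀ {n} {f : Fin n → Bool} → (∀ i → f i ≡ true) → count f ≡ n
count-full {n} all = trans (count-cong all) (trans (sum-const n 1) (*-identityʳ n))

count≡n⇒full : ∀ {n} (f : Fin n → Bool) → count f ≡ n → ∀ i → f i ≡ true
count≡n⇒full f c i = begin
  f i                     ≡⟨ lookup∘tabulate f i ⟨
  lookup (tabulate f) i   ≡⟨ cong (λ S → lookup S i) (∣p∣≡n⇒p≡⊤ {p = tabulate f} (trans (count-tabulate f) c)) ⟩
  lookup ⊤ i              ≡⟨ lookup-replicate i true ⟩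
  true                    ∎
  where open ≡-Reasoning

grid-count : ∀ {r′ m} (f : Fin (suc r′ * suc m) → Bool) (i0 : Fin (suc r′)) (v : Fin (suc m)) →
  (∀ j → j ≢ i0 → ∀ b → b ≢ v → f (combine j b) ≡ true) →
  r′ * m + count (λ b → f (combine i0 b)) ≤ count f
grid-count {r′} {m} f i0 v full = begin
  r′ * m + row i0                      ≡⟨ cong (_+ row i0) (sum-const r′ m) ⟨
  sum {r′} (λ _ → m) + row i0          ≤⟨ +-monoˡ-≤ (row i0) (sum-mono other-row≥m) ⟩
  sum (row ∘ punchIn i0) + row i0      ≡⟨ +-comm _ (row i0) ⟩
  row i0 + sum (row ∘ punchIn i0)      ≡⟨ sum-remove {i = i0} row ⟨
  sum row                              ≡⟨ sum-combine (suc r′) (indicator ∘ f) ⟨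
  count f                              ∎
  where
  open ≤-Reasoning
  row : Fin (suc r′) → ℕ
  row i = count (λ b → f (combine i b))
  other-row≥m : ∀ j → m ≤ row (punchIn i0 j)
  other-row≥m j = begin
    m                                             ≡⟨ count-full (λ a → full _ (punchInᵢ≢i i0 j) _ (punchInᵢ≢i v a)) ⟨
    count (row-f ∘ punchIn v)                     ≤⟨ m≤n+m _ _ ⟩
    indicator (row-f v) + count (row-f ∘ punchIn v) ≡⟨ count-remove v row-f ⟨
    count row-f                                   ∎
    where
    row-f : Fin (suc m) → Bool
    row-f b = f (combine (punchIn i0 j) b)

least-witness : ∀ {P : ℕ → Set} → (∀ n → Dec (P n)) → ∀ {n} → P n →
                ∃[ k ] (P k × ∀ j → j < k → ¬ P j)
least-witness {P} P? {n} = search 0 n (λ _ ())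
  where
  search : ∀ s d → (∀ j → j < s → ¬ P j) → P (s + d) → ∃[ k ] (P k × ∀ j → j < k → ¬ P j)
  search s d below p with P? s
  ... | yes ps = s , ps , below
  search s zero    below p | no ¬ps = ⊥-elim (¬ps (subst P (+-identityʳ s) p))
  search s (suc d) below p | no ¬ps = search (suc s) d below′ (subst P (+-suc s d) p)
    where
    below′ : ∀ j → j < suc s → ¬ P j
    below′ j j<1+s with m<1+n⇒m<n∨m≡n j<1+s
    ... | inj₁ j<s  = below j j<s
    ... | inj₂ refl = ¬ps

module Walks {n} (K : Graph n) where

  _++ʷ_ : ∀ {u w x a b} → Walk K u w a → Walk K w x b → Walk K u x (a + b)
  here       ++ʷ q = q
  step e p   ++ʷ q = step e (p ++ʷ q)

  walk? : ∀ k u x → Dec (Walk K u x k)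
  walk? zero u x with u ≟ᶠ x
  ... | yes refl = yes here
  ... | no u≢x   = no λ { here → u≢x refl }
  walk? (suc k) u x with any? (λ w → first-step w)
    where
    first-step : ∀ w → Dec (adj K u w ≡ true × Walk K w x k)
    first-step w with adj K u w | walk? k w x
    ... | true  | yes p  = yes (refl , p)
    ... | true  | no ¬p  = no (¬p ∘ proj₂)
    ... | false | _      = no λ ()
  ... | yes (w , e , p) = yes (step e p)
  ... | no ¬p           = no λ { (step e p) → ¬p (_ , e , p) }

  dist≤walk : ∀ {u x k j} → Dist K u x k → Walk K u x j → k ≤ j
  dist≤walk (_ , shortest) w = ≮⇒≥ (λ j<k → shortest _ j<k w)

  dist-unique : ∀ {u x k j} → Dist K u x k → Dist K u x j → k ≡ j
  dist-unique d d′ = ≤-antisym (dist≤walk d (proj₁ d′)) (dist≤walk d′ (proj₁ d))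

IsDistance : ∀ {n} → Graph n → (Fin n → Fin n → ℕ) → Set
IsDistance K d = ∀ u x → Dist K u x (d u x)

connected-distance : ∀ {n} (K : Graph n) → Connected K → ∃[ d ] IsDistance K d
connected-distance K conn =
  (λ u x → proj₁ (shortest u x)) , (λ u x → proj₂ (shortest u x))
  where
  open Walks K
  shortest : ∀ u x → ∃[ k ] Dist K u x k
  shortest u x = least-witness (λ k → walk? k u x) (proj₂ (conn u x))

module DistanceFunction {n} (K : Graph n) {d} (isDistance : IsDistance K d) where
  open Walks K

  d-refl : ∀ u → d u u ≡ 0
  d-refl u = ≤-antisym (dist≤walk (isDistance u u) here) z≤n

  d-triangle : ∀ u w x → d u x ≤ d u w + d w x
  d-triangle u w x = dist≤walk (isDistance u x) (proj₁ (isDistance u w) ++ʷ proj₁ (isDistance w x))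

  d-step : ∀ {u w} x → adj K u w ≡ true → d u x ≤ suc (d w x)
  d-step x e = dist≤walk (isDistance _ x) (step e (proj₁ (isDistance _ x)))

distance-criterion : ∀ {n} (K : Graph n) (d : Fin n → Fin n → ℕ) →
  (∀ u x → Walk K u x (d u x)) → (∀ u → d u u ≡ 0) →
  (∀ u w x → adj K u w ≡ true → d u x ≤ suc (d w x)) → IsDistance K d
distance-criterion K d walk diagonal growth u x = walk u x , λ j j<d w → <⇒≱ j<d (below w)
  where
  below : ∀ {u j} → Walk K u x j → d u x ≤ j
  below {u} here       = ≤-reflexive (diagonal u)
  below (step e w)     = ≤-trans (growth _ _ x e) (s≤s (below w))

Resolves : {A : Set} → (A → A → ℕ) → A → A → A → Set
Resolves d w u x = (d w u ≡ d w x + d x u) ⊎ (d w x ≡ d w u + d u x)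

Generates : {A : Set} → (A → A → ℕ) → (A → Bool) → Set
Generates d s = ∀ u x → u ≢ x → ∃[ w ] (s w ≡ true × Resolves d w u x)

resolves-swap : ∀ {A : Set} {d : A → A → ℕ} {w u x} → Resolves d w u x → Resolves d w x u
resolves-swap (inj₁ e) = inj₂ e
resolves-swap (inj₂ e) = inj₁ e

resolves-self : ∀ {A : Set} {d : A → A → ℕ} {w} x → d w w ≡ 0 → Resolves d w w x
resolves-self {d = d} {w} x d≡0 = inj₂ (cong (_+ d w x) (sym d≡0))

resolves-equidistant : ∀ {A : Set} {d : A → A → ℕ} {w u x} →
  d w u ≡ d w x → Resolves d w u x → d x u ≡ 0 ⊎ d u x ≡ 0
resolves-equidistant eq (inj₁ e) = inj₁ (+-cancelˡ-≡ _ _ 0 (trans (sym e) (trans eq (sym (+-identityʳ _)))))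
resolves-equidistant eq (inj₂ e) = inj₂ (+-cancelˡ-≡ _ _ 0 (trans (sym e) (trans (sym eq) (sym (+-identityʳ _)))))

resolves-cong : ∀ {A : Set} {d d′ : A → A → ℕ} → (∀ a a′ → d a a′ ≡ d′ a a′) →
                ∀ {w u x} → Resolves d w u x → Resolves d′ w u x
resolves-cong d≗d′ {w} {u} {x} (inj₁ e) =
  inj₁ (trans (sym (d≗d′ w u)) (trans e (cong₂ _+_ (d≗d′ w x) (d≗d′ x u))))
resolves-cong d≗d′ {w} {u} {x} (inj₂ e) =
  inj₂ (trans (sym (d≗d′ w x)) (trans e (cong₂ _+_ (d≗d′ w u) (d≗d′ u x))))

generates-mono : ∀ {A : Set} {d : A → A → ℕ} {s s′ : A → Bool} →
                 (∀ a → s a ≡ true → s′ a ≡ true) → Generates d s → Generates d s′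
generates-mono s⊆s′ gen u x u≢x with gen u x u≢x
... | w , sw , r = w , s⊆s′ w sw , r

module _ {n} (K : Graph n) {d} (isDistance : IsDistance K d) where
  open Walks K

  strongly-resolves⇔ : ∀ w u x → StronglyResolves K w u x ⇔ Resolves d w u x
  strongly-resolves⇔ w u x = mk⇔ to′ from′
    where
    to′ : StronglyResolves K w u x → Resolves d w u x
    to′ (inj₁ (_ , _ , _ , wu , wx , xu , e)) =
      inj₁ (trans (dist-unique (isDistance w u) wu)
             (trans e (cong₂ _+_ (dist-unique wx (isDistance w x)) (dist-unique xu (isDistance x u)))))
    to′ (inj₂ (_ , _ , _ , wx , wu , ux , e)) =
      inj₂ (trans (dist-unique (isDistance w x) wx)
             (trans e (cong₂ _+_ (dist-unique wu (isDistance w u)) (dist-unique ux (isDistance u x)))))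
    from′ : Resolves d w u x → StronglyResolves K w u x
    from′ (inj₁ e) = inj₁ (_ , _ , _ , isDistance w u , isDistance w x , isDistance x u , e)
    from′ (inj₂ e) = inj₂ (_ , _ , _ , isDistance w x , isDistance w u , isDistance u x , e)

  generator⇔ : ∀ S → IsStrongMetricGenerator K S ⇔ Generates d (lookup S)
  generator⇔ S = mk⇔ to′ from′
    where
    to′ : IsStrongMetricGenerator K S → Generates d (lookup S)
    to′ gen u x u≢x with gen u x u≢x
    ... | w , w∈S , r = w , []=⇒lookup w∈S , to (strongly-resolves⇔ w u x) r
    from′ : Generates d (lookup S) → IsStrongMetricGenerator K S
    from′ gen u x u≢x with gen u x u≢x
    ... | w , w∈S , r = w , lookup⇒[]= w S w∈S , from (strongly-resolves⇔ w u x) r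

generates-rename : ∀ {A B : Set} (f : A → B) (g : B → A) →
  (∀ a → g (f a) ≡ a) → (∀ b → f (g b) ≡ b) →
  ∀ {d : B → B → ℕ} {s : A → Bool} →
  Generates (λ a a′ → d (f a) (f a′)) s ⇔ Generates d (s ∘ g)
generates-rename f g gf fg {d} {s} = mk⇔ to′ from′
  where
  to′ : Generates (λ a a′ → d (f a) (f a′)) s → Generates d (s ∘ g)
  to′ gen u x u≢x with gen (g u) (g x) (u≢x ∘ λ e → trans (sym (fg u)) (trans (cong f e) (fg x)))
  ... | w , sw , r = f w , trans (cong s (gf w)) sw ,
                     subst₂ (Resolves d (f w)) (fg u) (fg x) r
  from′ : Generates d (s ∘ g) → Generates (λ a a′ → d (f a) (f a′)) s
  from′ gen u x u≢x with gen (f u) (f x) (u≢x ∘ λ e → trans (sym (gf u)) (trans (cong g e) (gf x)))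
  ... | w , sw , r = g w , sw , subst (λ a → Resolves d a (f u) (f x)) (sym (fg w)) r

adj⇒≢ : ∀ {n} (K : Graph n) {u x} → adj K u x ≡ true → u ≢ x
adj⇒≢ K {u} e refl with trans (sym e) (adjIrr K u)
... | ()

-- In a graph of diameter at most two the distance is determined by
-- adjacency alone: it is the truncated distance d₂ (0, 1 or 2).
module Truncated {n} (K : Graph n) where

  d₂ : Fin n → Fin n → ℕ
  d₂ u x with u ≟ᶠ x
  ... | yes _ = 0
  ... | no  _ = if adj K u x then 1 else 2

  d₂-refl : ∀ u → d₂ u u ≡ 0
  d₂-refl u with u ≟ᶠ u
  ... | yes _   = refl
  ... | no u≢u  = ⊥-elim (u≢u refl)

  d₂-adj : ∀ {u x} → adj K u x ≡ true → d₂ u x ≡ 1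
  d₂-adj {u} {x} e with u ≟ᶠ x
  ... | yes u≡x = ⊥-elim (adj⇒≢ K e u≡x)
  ... | no  _   rewrite e = refl

  d₂-nonadj : ∀ {u x} → u ≢ x → adj K u x ≡ false → d₂ u x ≡ 2
  d₂-nonadj {u} {x} u≢x e with u ≟ᶠ x
  ... | yes u≡x = ⊥-elim (u≢x u≡x)
  ... | no  _   rewrite e = refl

  d₂≤2 : ∀ u x → d₂ u x ≤ 2
  d₂≤2 u x with u ≟ᶠ x
  ... | yes _ = z≤n
  ... | no  _ with adj K u x
  ...   | true  = s≤s z≤n
  ...   | false = ≤-refl

  d₂≡0⇒≡ : ∀ {u x} → d₂ u x ≡ 0 → u ≡ x
  d₂≡0⇒≡ {u} {x} e with u ≟ᶠ x
  ... | yes u≡x = u≡x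
  ... | no  _   with adj K u x
  d₂≡0⇒≡ () | no _ | true
  d₂≡0⇒≡ () | no _ | false

  d₂≤1⇒adj : ∀ {u x} → u ≢ x → d₂ u x ≤ 1 → adj K u x ≡ true
  d₂≤1⇒adj {u} {x} u≢x le with u ≟ᶠ x
  ... | yes u≡x = ⊥-elim (u≢x u≡x)
  ... | no  _   with adj K u x
  ...   | true  = refl
  d₂≤1⇒adj u≢x (s≤s ()) | no _ | false

  d₂≤walk : ∀ {u x k} → Walk K u x k → d₂ u x ≤ k
  d₂≤walk {u} {x} w with u ≟ᶠ x
  ... | yes _   = z≤n
  ... | no  u≢x with adj K u x in e | w
  ...   | _     | here            = ⊥-elim (u≢x refl)
  ...   | true  | step _ _        = s≤s z≤n
  ...   | false | step e′ here    with trans (sym e′) e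
  ...     | ()
  d₂≤walk w | no _ | false | step _ (step _ _) = s≤s (s≤s z≤n)

  walk-d₂ : DiameterAtMost K 2 → ∀ u x → Walk K u x (d₂ u x)
  walk-d₂ diam u x with u ≟ᶠ x
  ... | yes refl = here
  ... | no  u≢x with adj K u x in e | diam u x
  ...   | true  | _                            = step e here
  ...   | false | k , k≤2 , w =
    subst (Walk K u x) (≤-antisym k≤2 (subst (_≤ k) (d₂-nonadj u≢x e) (d₂≤walk w))) w

  diameter⇒diameter≤ : ∀ {d} → HasDiameter K d → DiameterAtMost K d
  diameter⇒diameter≤ (bounded , _) u x with bounded u x
  ... | k , k≤d , dist = k , k≤d , proj₁ dist

  diameter≤2⇒distance : DiameterAtMost K 2 → IsDistance K d₂
  diameter≤2⇒distance diam u x = walk-d₂ diam u x , λ j j<d w → <⇒≱ j<d (d₂≤walk w)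

  universal⇒diameter≤2 : ∀ a → (∀ x → x ≢ a → adj K a x ≡ true) → DiameterAtMost K 2
  universal⇒diameter≤2 a universal u x with u ≟ᶠ x | u ≟ᶠ a | x ≟ᶠ a
  ... | yes refl | _        | _        = 0 , z≤n , here
  ... | no  u≢x  | yes refl | _        = 1 , s≤s z≤n , step (universal x (u≢x ∘ sym)) here
  ... | no  _    | no  u≢a  | yes refl = 1 , s≤s z≤n , step (trans (adjSym K u a) (universal u u≢a)) here
  ... | no  _    | no  u≢a  | no  x≢a  =
    2 , ≤-refl , step (trans (adjSym K u a) (universal u u≢a)) (step (universal x x≢a) here)

d₂-deleteVertex : ∀ {m} (H : Graph (suc m)) v a a′ →
  Truncated.d₂ (deleteVertex H v) a a′ ≡ Truncated.d₂ H (punchIn v a) (punchIn v a′)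
d₂-deleteVertex H v a a′ with a ≟ᶠ a′ | punchIn v a ≟ᶠ punchIn v a′
... | yes _    | yes _ = refl
... | no  _    | no  _ = refl
... | yes refl | no ne = ⊥-elim (ne refl)
... | no  ne   | yes e = ⊥-elim (ne (punchIn-injective v a a′ e))

degree-universal : ∀ {m} (H : Graph (suc m)) v → degree H v ≡ m → ∀ b → b ≢ v → adj H v b ≡ true
degree-universal {m} H v deg b b≢v =
  subst (λ c → adj H v c ≡ true) (punchIn-punchOut v≢b)
        (count≡n⇒full (adj H v ∘ punchIn v) others (punchOut v≢b))
  where
  v≢b : v ≢ b
  v≢b = b≢v ∘ sym
  others : count (adj H v ∘ punchIn v) ≡ m
  others = begin
    count (adj H v ∘ punchIn v)                            ≡⟨ cong (λ a → indicator a + count (adj H v ∘ punchIn v)) (adjIrr H v) ⟨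
    indicator (adj H v v) + count (adj H v ∘ punchIn v)    ≡⟨ count-remove v (adj H v) ⟨
    count (adj H v)                                        ≡⟨ count-tabulate (adj H v) ⟨
    degree H v                                             ≡⟨ deg ⟩
    m                                                      ∎
    where open ≡-Reasoning

module Cone {m} (H : Graph (suc m)) (v : Fin (suc m))
            (universal : ∀ b → b ≢ v → adj H v b ≡ true) where
  open Truncated H public

  dH-distance : IsDistance H d₂
  dH-distance = diameter≤2⇒distance (universal⇒diameter≤2 v universal)

  root-leaf : ∀ {b} → b ≢ v → d₂ v b ≡ 1
  root-leaf b≢v = d₂-adj (universal _ b≢v)

  leaf-root : ∀ {b} → b ≢ v → d₂ b v ≡ 1
  leaf-root {b} b≢v = d₂-adj (trans (adjSym H b v) (universal b b≢v))

  to-root≤1 : ∀ c → d₂ c v ≤ 1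
  to-root≤1 c with c ≟ᶠ v
  ... | yes _   = z≤n
  ... | no  c≢v rewrite trans (adjSym H c v) (universal c c≢v) = ≤-refl

  -- The root sees all leaves at distance one, so it resolves no two of them.
  root-resolves-no-leaves : ∀ {b y} → b ≢ v → y ≢ v → b ≢ y → ¬ Resolves d₂ v b y
  root-resolves-no-leaves {b} {y} b≢v y≢v b≢y r
    with resolves-equidistant {d = d₂} {v} {b} {y} (trans (root-leaf b≢v) (sym (root-leaf y≢v))) r
  ... | inj₁ e = b≢y (sym (d₂≡0⇒≡ e))
  ... | inj₂ e = b≢y (d₂≡0⇒≡ e)

  LeafResolving : (Fin (suc m) → Bool) → Set
  LeafResolving s = ∀ b y → b ≢ v → y ≢ v → b ≢ y → ∃[ c ] (s c ≡ true × Resolves d₂ c b y)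

  MinimumLeafResolving : ℕ → Set
  MinimumLeafResolving k =
    (∃[ s0 ] (LeafResolving s0 × count s0 ≡ k)) × (∀ s → LeafResolving s → k ≤ count s)

-- A vertex of X is a pair
-- (i , b): vertex b of the i-th copy of H.  Within a copy the distance is
-- dH; between copies one must pass through both roots:
--   D (i , b) (j , y) = dH b v + dG i j + dH v y     (i ≢ j).
module RootedProduct {r t} (G : Graph r) (H : Graph t) (v : Fin t)
  {dG} (dG-distance : IsDistance G dG) {dH} (dH-distance : IsDistance H dH) where

  module DG = DistanceFunction G dG-distance
  module DH = DistanceFunction H dH-distance

  X : Graph (r * t)
  X = rootedProduct G v H

  Vertex : Set
  Vertex = Fin r × Fin t

  code : Vertex → Fin (r * t)
  code (i , b) = combine i b

  decode : Fin (r * t) → Vertex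
  decode = remQuot {r} t

  decode-code : ∀ p → decode (code p) ≡ p
  decode-code (i , b) = remQuot-combine i b

  code-decode : ∀ q → code (decode q) ≡ q
  code-decode = combine-remQuot {r} t

  D : Vertex → Vertex → ℕ
  D (i , b) (j , y) with i ≟ᶠ j
  ... | yes _ = dH b y
  ... | no  _ = dH b v + dG i j + dH v y

  D-same : ∀ i b y → D (i , b) (i , y) ≡ dH b y
  D-same i b y with i ≟ᶠ i
  ... | yes _   = refl
  ... | no  i≢i = ⊥-elim (i≢i refl)

  D-diff : ∀ {i j} b y → i ≢ j → D (i , b) (j , y) ≡ dH b v + dG i j + dH v y
  D-diff {i} {j} b y i≢j with i ≟ᶠ j
  ... | yes i≡j = ⊥-elim (i≢j i≡j)
  ... | no  _   = refl

  adj-code : ∀ p q → adj X (code p) (code q) ≡ rpAdj G v H (proj₁ p) (proj₂ p) (proj₁ q) (proj₂ q)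
  adj-code p q = cong₂ (λ p′ q′ → rpAdj G v H (proj₁ p′) (proj₂ p′) (proj₁ q′) (proj₂ q′))
                       (decode-code p) (decode-code q)

  copy-edge : ∀ i {b y} → adj H b y ≡ true → adj X (code (i , b)) (code (i , y)) ≡ true
  copy-edge i {b} {y} e rewrite adj-code (i , b) (i , y) | ==-refl i | e = refl

  root-edge : ∀ {i j} → adj G i j ≡ true → adj X (code (i , v)) (code (j , v)) ≡ true
  root-edge {i} {j} e rewrite adj-code (i , v) (j , v) | ==-refl v | e = ∨-zeroʳ _

  in-copy : ∀ i {b y k} → Walk H b y k → Walk X (code (i , b)) (code (i , y)) k
  in-copy i here       = here
  in-copy i (step e w) = step (copy-edge i e) (in-copy i w)

  along-roots : ∀ {i j k} → Walk G i j k → Walk X (code (i , v)) (code (j , v)) k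
  along-roots here       = here
  along-roots (step e w) = step (root-edge e) (along-roots w)

  open Walks X using (_++ʷ_)

  walk-D : ∀ p q → Walk X (code p) (code q) (D p q)
  walk-D (i , b) (j , y) with i ≟ᶠ j
  ... | yes refl = in-copy i (proj₁ (dH-distance b y))
  ... | no  _    = (in-copy i (proj₁ (dH-distance b v)) ++ʷ along-roots (proj₁ (dG-distance i j)))
                   ++ʷ in-copy j (proj₁ (dH-distance v y))

  joins-roots : ∀ {b y c} → ((b == v) ∧ (y == v)) ∧ c ≡ true → b ≡ v × y ≡ v × c ≡ true
  joins-roots {b} {y} {c} e with b ≟ᶠ v | y ≟ᶠ v | c
  ... | yes b≡v | yes y≡v | true = b≡v , y≡v , refl
  joins-roots () | yes _ | yes _ | false
  joins-roots () | yes _ | no  _ | _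
  joins-roots () | no  _ | _     | _

  edge-cases : ∀ i b j y → rpAdj G v H i b j y ≡ true →
               (i ≡ j × adj H b y ≡ true) ⊎ (b ≡ v × y ≡ v × adj G i j ≡ true)
  edge-cases i b j y e with i ≟ᶠ j | adj H b y
  ... | yes i≡j | true  = inj₁ (i≡j , refl)
  ... | yes _   | false = inj₂ (joins-roots e)
  ... | no  _   | _     = inj₂ (joins-roots e)

  D-step : ∀ p p′ q → rpAdj G v H (proj₁ p) (proj₂ p) (proj₁ p′) (proj₂ p′) ≡ true →
           D p q ≤ suc (D p′ q)
  D-step (i , b) (i′ , b′) (j , y) e with edge-cases i b i′ b′ e
  D-step (i , b) (.i , b′) (j , y) e | inj₁ (refl , e′) with i ≟ᶠ j
  ... | yes refl = DH.d-step y e′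
  ... | no  _    = +-monoˡ-≤ (dH v y) (+-monoˡ-≤ (dG i j) (DH.d-step v e′))
  D-step (i , .v) (i′ , .v) (j , y) e | inj₂ (refl , refl , e′) with i ≟ᶠ j | i′ ≟ᶠ j
  ... | yes refl | yes refl = ⊥-elim (adj⇒≢ G e′ refl)
  ... | yes refl | no  _    = ≤-trans (m≤n+m (dH v y) _) (n≤1+n _)
  ... | no  _    | yes refl rewrite DH.d-refl v =
    +-monoˡ-≤ (dH v y) (≤-trans (DG.d-step i′ e′) (s≤s (≤-reflexive (DG.d-refl i′))))
  ... | no  _    | no  _    rewrite DH.d-refl v = +-monoˡ-≤ (dH v y) (DG.d-step j e′)

  D-distance : IsDistance X (λ p q → D (decode p) (decode q))
  D-distance = distance-criterion X (λ p q → D (decode p) (decode q))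
    (λ p q → subst₂ (λ a c → Walk X a c (D (decode p) (decode q))) (code-decode p) (code-decode q) (walk-D (decode p) (decode q)))
    (λ p → trans (D-same (proj₁ (decode p)) (proj₂ (decode p)) _) (DH.d-refl _))
    (λ p p′ q → D-step (decode p) (decode p′) (decode q))

  product-generator⇔ : ∀ S → IsStrongMetricGenerator X S ⇔ Generates D (lookup S ∘ code)
  product-generator⇔ S = mk⇔ (to rename ∘ to (generator⇔ X D-distance S))
                             (from (generator⇔ X D-distance S) ∘ from rename)
    where
    rename : Generates (λ p q → D (decode p) (decode q)) (lookup S) ⇔ Generates D (lookup S ∘ code)
    rename = generates-rename decode code code-decode decode-code

  via-own-root : ∀ {i j} b y → i ≢ j → D (i , b) (j , y) ≡ D (i , b) (i , v) + D (i , v) (j , y)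
  via-own-root {i} {j} b y i≢j rewrite D-diff b y i≢j | D-same i b v | D-diff v y i≢j | DH.d-refl v =
    +-assoc (dH b v) (dG i j) (dH v y)

  via-other-root : ∀ {l i} c y → l ≢ i → D (l , c) (i , y) ≡ D (l , c) (i , v) + D (i , v) (i , y)
  via-other-root {l} {i} c y l≢i rewrite D-diff c y l≢i | D-diff c v l≢i | D-same i v y | DH.d-refl v =
    cong (_+ dH v y) (sym (+-identityʳ _))

  in-copy⇔ : ∀ i c b y → Resolves D (i , c) (i , b) (i , y) ⇔ Resolves dH c b y
  in-copy⇔ i c b y rewrite D-same i c b | D-same i c y | D-same i y b | D-same i b y = mk⇔ id id

module ConeProduct {r′ m} (G : Graph (suc r′)) (H : Graph (suc m)) (v : Fin (suc m))
  (universal : ∀ b → b ≢ v → adj H v b ≡ true) {dG} (dG-distance : IsDistance G dG) where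
  open Cone H v universal public
  open RootedProduct G H v dG-distance dH-distance public

  across : ∀ {i j} b y → i ≢ j → b ≢ v → y ≢ v → D (i , b) (j , y) ≡ 1 + dG i j + 1
  across b y i≢j b≢v y≢v = trans (D-diff b y i≢j) (cong₂ (λ p q → p + _ + q) (leaf-root b≢v) (root-leaf y≢v))

  toward-copy : ∀ {l i} c b → l ≢ i → b ≢ v → D (l , c) (i , b) ≡ d₂ c v + dG l i + 1
  toward-copy c b l≢i b≢v = trans (D-diff c b l≢i) (cong (_ +_) (root-leaf b≢v))

  far-copy-blind : ∀ {l i c b y} → l ≢ i → b ≢ v → y ≢ v → b ≢ y →
                   ¬ Resolves D (l , c) (i , b) (i , y)
  far-copy-blind {l} {i} {c} {b} {y} l≢i b≢v y≢v b≢y r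
    with resolves-equidistant {d = D} {l , c} {i , b} {i , y}
           (trans (toward-copy c b l≢i b≢v) (sym (toward-copy c y l≢i y≢v))) r
  ... | inj₁ e = b≢y (sym (d₂≡0⇒≡ (trans (sym (D-same i y b)) e)))
  ... | inj₂ e = b≢y (d₂≡0⇒≡ (trans (sym (D-same i b y)) e))

  resolver-is-endpoint : ∀ {l c i b j y} → i ≢ j → b ≢ v → y ≢ v →
    D (l , c) (i , b) ≡ D (l , c) (j , y) + D (j , y) (i , b) → (l , c) ≡ (j , y)
  resolver-is-endpoint {l} {c} {i} {b} {j} {y} i≢j b≢v y≢v eq = cases (l ≟ᶠ i) (l ≟ᶠ j)
    where
    open ≤-Reasoning
    two-steps : ∀ g → 2 + g ≡ 1 + g + 1
    two-steps g = cong suc (+-comm 1 g)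
    cases : Dec (l ≡ i) → Dec (l ≡ j) → (l , c) ≡ (j , y)
    -- inside copy i the distance is at most 2, but the right side is at least 3
    cases (yes refl) _ = ⊥-elim (<⇒≱ (begin-strict
      2                                     <⟨ +-mono-≤ to-y≥1 across≥2 ⟩
      D (l , c) (j , y) + D (j , y) (l , b) ≡⟨ sym eq ⟩
      D (l , c) (l , b)                     ≡⟨ D-same l c b ⟩
      d₂ c b                                ∎) (d₂≤2 c b))
      where
      to-y≥1 : 1 ≤ D (l , c) (j , y)
      to-y≥1 = begin
        1                      ≡⟨ root-leaf y≢v ⟨
        d₂ v y                 ≤⟨ m≤n+m _ _ ⟩
        d₂ c v + dG l j + d₂ v y ≡⟨ D-diff c y i≢j ⟨
        D (l , c) (j , y)      ∎
      across≥2 : 2 ≤ D (j , y) (l , b)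
      across≥2 = begin
        2                      ≤⟨ s≤s (m≤n+m 1 (dG j l)) ⟩
        1 + dG j l + 1         ≡⟨ across y b (i≢j ∘ sym) y≢v b≢v ⟨
        D (j , y) (l , b)      ∎
    -- in copy j, d₂ c v ≤ 1 forces d₂ c y = 0
    cases (no l≢i) (yes refl) = cong (l ,_) (d₂≡0⇒≡ (n≤0⇒n≡0 (+-cancelʳ-≤ (2 + dG l i) _ 0 (begin
      d₂ c y + (2 + dG l i)                  ≡⟨ cong₂ _+_ (sym (D-same l c y))
                                                  (trans (two-steps (dG l i)) (sym (across y b l≢i y≢v b≢v))) ⟩
      D (l , c) (l , y) + D (l , y) (i , b)  ≡⟨ sym eq ⟩
      D (l , c) (i , b)                      ≡⟨ toward-copy c b l≢i b≢v ⟩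
      d₂ c v + dG l i + 1                    ≤⟨ +-monoˡ-≤ 1 (+-monoˡ-≤ (dG l i) (to-root≤1 c)) ⟩
      1 + dG l i + 1                         ≡⟨ two-steps (dG l i) ⟨
      2 + dG l i                             ∎))))
    -- elsewhere, the triangle inequality in G is violated
    cases (no l≢i) (no l≢j) = ⊥-elim (m+1+n≰m (D (l , c) (i , b)) (begin
      D (l , c) (i , b) + 2                                    ≡⟨ cong (_+ 2) (toward-copy c b l≢i b≢v) ⟩
      d₂ c v + dG l i + 1 + 2                                  ≤⟨ +-monoˡ-≤ 2 (+-monoˡ-≤ 1 (+-monoʳ-≤ (d₂ c v) (DG.d-triangle l j i))) ⟩
      d₂ c v + (dG l j + dG j i) + 1 + 2                       ≡⟨ regroup (d₂ c v) (dG l j) (dG j i) ⟩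
      (d₂ c v + dG l j + 1) + (1 + dG j i + 1)                 ≡⟨ cong₂ _+_ (toward-copy c y l≢j y≢v) (across y b (i≢j ∘ sym) y≢v b≢v) ⟨
      D (l , c) (j , y) + D (j , y) (i , b)                    ≡⟨ eq ⟨
      D (l , c) (i , b)                                        ∎))
      where
      regroup : ∀ a x y → a + (x + y) + 1 + 2 ≡ a + x + 1 + (1 + y + 1)
      regroup = solve-∀

  module Generator {s : Vertex → Bool} (generates : Generates D s) where

    -- Two leaves of one copy are resolved only from inside that copy, so
    -- the part of s in any copy resolves the leaves of that copy within H.
    copy-leaf-resolving : ∀ i → LeafResolving (λ b → s (i , b))
    copy-leaf-resolving i b y b≢v y≢v b≢y with generates (i , b) (i , y) (b≢y ∘ cong proj₂)
    ... | (l , c) , sw , r = c , locate (l ≟ᶠ i) sw r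
      where
      locate : Dec (l ≡ i) → s (l , c) ≡ true → Resolves D (l , c) (i , b) (i , y) →
                s (i , c) ≡ true × Resolves d₂ c b y
      locate (yes refl) sw r = sw , to (in-copy⇔ l c b y) r
      locate (no l≢i)   _  r = ⊥-elim (far-copy-blind l≢i b≢v y≢v b≢y r)

    cross-pair : ∀ {i j b y} → i ≢ j → b ≢ v → y ≢ v → s (i , b) ≡ true ⊎ s (j , y) ≡ true
    cross-pair {i} {j} {b} {y} i≢j b≢v y≢v with generates (i , b) (j , y) (i≢j ∘ cong proj₁)
    ... | w , sw , inj₁ e = inj₂ (subst (λ z → s z ≡ true) (resolver-is-endpoint i≢j b≢v y≢v e) sw)
    ... | w , sw , inj₂ e = inj₁ (subst (λ z → s z ≡ true) (resolver-is-endpoint (i≢j ∘ sym) y≢v b≢v e) sw)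

    full-except-one : ∃[ i0 ] (∀ j → j ≢ i0 → ∀ b → b ≢ v → s (j , b) ≡ true)
    full-except-one with any? (λ i → any? (λ b → ¬? (b ≟ᶠ v) ×-dec (s (i , b) ≟ᵇ false)))
    ... | yes (i0 , b0 , b0≢v , missing) = i0 , others
      where
      others : ∀ j → j ≢ i0 → ∀ b → b ≢ v → s (j , b) ≡ true
      others j j≢i0 b b≢v with cross-pair (j≢i0 ∘ sym) b0≢v b≢v
      ... | inj₂ present = present
      ... | inj₁ present with trans (sym present) missing
      ...   | ()
    ... | no none = zero , λ j _ b b≢v → all-present j b b≢v
      where
      all-present : ∀ j b → b ≢ v → s (j , b) ≡ true
      all-present j b b≢v with s (j , b) in e
      ... | true  = refl
      ... | false = ⊥-elim (none (j , b , b≢v , e))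

  lower-bound : ∀ S → IsStrongMetricGenerator X S →
                ∃[ row ] (LeafResolving row × r′ * m + count row ≤ ∣ S ∣)
  lower-bound S gen =
    row , copy-leaf-resolving i0 ,
    ≤-trans (grid-count (lookup S) i0 v full) (≤-reflexive (sym (count-lookup S)))
    where
    open Generator (to (product-generator⇔ S) gen)
    i0 : Fin (suc r′)
    i0 = proj₁ full-except-one
    full : ∀ j → j ≢ i0 → ∀ b → b ≢ v → lookup S (code (j , b)) ≡ true
    full = proj₂ full-except-one
    row : Fin (suc m) → Bool
    row b = lookup S (code (i0 , b))

  module Construction (other : Fin r′) (leaf : Fin (suc m)) (leaf≢v : leaf ≢ v)
                      (s0 : Fin (suc m) → Bool) (s0-resolving : LeafResolving s0) where

    chosen : Vertex → Bool
    chosen (zero  , b) = s0 b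
    chosen (suc _ , b) = not (b == v)

    chosen-leaf : ∀ i → chosen (suc i , leaf) ≡ true
    chosen-leaf i = cong not (dec-false (leaf ≟ᶠ v) leaf≢v)

    unchosen-root : ∀ i b → chosen (suc i , b) ≡ false → b ≡ v
    unchosen-root i b e with b ≟ᶠ v
    ... | yes b≡v = b≡v
    unchosen-root i b () | no _

    D-refl : ∀ p → D p p ≡ 0
    D-refl (i , b) = trans (D-same i b b) (d₂-refl b)

    -- Two vertices outside `chosen` are roots or leaves of copy zero.
    unchosen-pair : ∀ p q → p ≢ q → chosen p ≡ false → chosen q ≡ false →
                    ∃[ w ] (chosen w ≡ true × Resolves D w p q)
    unchosen-pair (suc i , b) (j , y) p≢q cp cq with unchosen-root i b cp
    ... | refl = (suc i , leaf) , chosen-leaf i , inj₂ (via-own-root leaf y i≢j)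
      where
      i≢j : suc i ≢ j
      i≢j refl = p≢q (cong (suc i ,_) (sym (unchosen-root i y cq)))
    unchosen-pair (zero , b) (suc j , y) p≢q cp cq with unchosen-root j y cq
    ... | refl = (suc j , leaf) , chosen-leaf j , inj₁ (via-own-root {suc j} {zero} leaf b λ ())
    unchosen-pair (zero , b) (zero , y) p≢q cp cq with b ≟ᶠ v | y ≟ᶠ v
    ... | yes refl | _        = (suc other , leaf) , chosen-leaf other , inj₂ (via-other-root {suc other} {zero} leaf y λ ())
    ... | no  _    | yes refl = (suc other , leaf) , chosen-leaf other , inj₁ (via-other-root {suc other} {zero} leaf b λ ())
    ... | no  b≢v  | no  y≢v  with s0-resolving b y b≢v y≢v (p≢q ∘ cong (zero ,_))
    ...   | c , s0c , r = (zero , c) , s0c , from (in-copy⇔ zero c b y) r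

    chosen-generates : Generates D chosen
    chosen-generates p q p≢q with chosen p in cp | chosen q in cq
    ... | true  | _     = p , cp , resolves-self {d = D} q (D-refl p)
    ... | false | true  = q , cq , resolves-swap {d = D} {q} {q} {p} (resolves-self {d = D} p (D-refl q))
    ... | false | false = unchosen-pair p q p≢q cp cq

    chosen-set : Subset (suc r′ * suc m)
    chosen-set = tabulate (chosen ∘ decode)

    chosen-set-generator : IsStrongMetricGenerator X chosen-set
    chosen-set-generator = from (product-generator⇔ chosen-set)
      (generates-mono (λ p e → trans (lookup∘tabulate (chosen ∘ decode) (code p))
                                     (trans (cong chosen (decode-code p)) e))
                      chosen-generates)

    chosen-set-size : ∣ chosen-set ∣ ≡ r′ * m + count s0
    chosen-set-size = begin
      ∣ chosen-set ∣                                          ≡⟨ count-tabulate (chosen ∘ decode) ⟩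
      count (chosen ∘ decode)                                 ≡⟨ sum-combine (suc r′) (indicator ∘ chosen ∘ decode) ⟩
      sum (λ i → count (λ b → chosen (decode (code (i , b))))) ≡⟨ sum-cong-≗ (λ i → count-cong (λ b → cong chosen (decode-code (i , b)))) ⟩
      count s0 + sum {r′} (λ _ → count (λ b → not (b == v)))  ≡⟨ cong (λ n → count s0 + n) (trans (sum-const r′ _) (cong (r′ *_) leaves)) ⟩
      count s0 + r′ * m                                       ≡⟨ +-comm (count s0) (r′ * m) ⟩
      r′ * m + count s0                                       ∎
      where
      open ≡-Reasoning
      leaves : count (λ b → not (b == v)) ≡ m
      leaves = trans (count-remove v (λ b → not (b == v))) (cong₂ (λ x n → indicator (not x) + n) (==-refl v)
                 (count-full (λ a → cong not (dec-false (punchIn v a ≟ᶠ v) (punchInᵢ≢i v a)))))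

  product-dimension : Fin r′ → ∀ leaf → leaf ≢ v → ∀ k → MinimumLeafResolving k →
                      IsStrongMetricDim X (r′ * m + k)
  product-dimension other leaf leaf≢v k ((s0 , s0-resolving , size) , minimal) =
    (chosen-set , chosen-set-generator , trans chosen-set-size (cong (r′ * m +_) size)) ,
    λ S gen → let (row , resolving , bound) = lower-bound S gen in
              ≤-trans (+-monoʳ-≤ (r′ * m) (minimal row resolving)) bound
    where open Construction other leaf leaf≢v s0 s0-resolving

module LeafResolvingSets {m} (H : Graph (suc m)) (v : Fin (suc m))
  (universal : ∀ b → b ≢ v → adj H v b ≡ true) where
  open Cone H v universal

  H′ : Graph m
  H′ = deleteVertex H v

  module T′ = Truncated H′

  leaf-of : ∀ {b} → b ≢ v → ∃[ a ] punchIn v a ≡ b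
  leaf-of b≢v = punchOut (b≢v ∘ sym) , punchIn-punchOut (b≢v ∘ sym)

  module SmallDiameter (diam : DiameterAtMost H′ 2) where

    H′-distance : IsDistance H′ T′.d₂
    H′-distance = T′.diameter≤2⇒distance diam

    -- A strong generator of H − v, extended by v ∉ S, is leaf-resolving; a
    -- leaf-resolving set never needs the root, so restricts to a generator.
    generator⇒leaf-resolving : ∀ T → IsStrongMetricGenerator H′ T → LeafResolving (lookup (insertAt T v false))
    generator⇒leaf-resolving T gen b y b≢v y≢v b≢y with leaf-of b≢v | leaf-of y≢v
    ... | a , refl | a′ , refl with to (generator⇔ H′ H′-distance T) gen a a′ (b≢y ∘ cong (punchIn v))
    ...   | c , c∈T , r = punchIn v c , trans (insertAt-punchIn T v false c) c∈T ,
                          resolves-cong (d₂-deleteVertex H v) r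

    leaf-resolving⇒generator : ∀ s → LeafResolving s → IsStrongMetricGenerator H′ (tabulate (s ∘ punchIn v))
    leaf-resolving⇒generator s resolving = from (generator⇔ H′ H′-distance _) gen
      where
      gen : Generates T′.d₂ (lookup (tabulate (s ∘ punchIn v)))
      gen a a′ a≢a′ with resolving (punchIn v a) (punchIn v a′) (punchInᵢ≢i v a) (punchInᵢ≢i v a′)
                                   (a≢a′ ∘ punchIn-injective v a a′)
      ... | c , sc , r with c ≟ᶠ v
      ...   | yes refl = ⊥-elim (root-resolves-no-leaves (punchInᵢ≢i v a) (punchInᵢ≢i v a′)
                                   (a≢a′ ∘ punchIn-injective v a a′) r)
      ...   | no  c≢v with leaf-of c≢v
      ...     | c′ , refl = c′ , trans (lookup∘tabulate (s ∘ punchIn v) c′) sc ,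
                            resolves-cong (λ x y → sym (d₂-deleteVertex H v x y)) r

    minimum : ∀ k → IsStrongMetricDim H′ k → MinimumLeafResolving k
    minimum k ((T0 , gen0 , size0) , minimal) =
      (lookup (insertAt T0 v false) , generator⇒leaf-resolving T0 gen0 , trans extended-size size0) ,
      λ s resolving → begin
        k                           ≤⟨ minimal _ (leaf-resolving⇒generator s resolving) ⟩
        ∣ tabulate (s ∘ punchIn v) ∣ ≡⟨ count-tabulate (s ∘ punchIn v) ⟩
        count (s ∘ punchIn v)       ≤⟨ m≤n+m _ _ ⟩
        indicator (s v) + count (s ∘ punchIn v) ≡⟨ count-remove v s ⟨
        count s                     ∎
      where
      open ≤-Reasoning
      extended-size : count (lookup (insertAt T0 v false)) ≡ ∣ T0 ∣
      extended-size = ≡.begin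
        count (lookup (insertAt T0 v false)) ≡.≡⟨ count-remove v (lookup (insertAt T0 v false)) ⟩
        indicator (lookup (insertAt T0 v false) v) + count (lookup (insertAt T0 v false) ∘ punchIn v)
          ≡.≡⟨ cong₂ (λ x n → indicator x + n) (insertAt-lookup T0 v false) (count-cong (insertAt-punchIn T0 v false)) ⟩
        count (lookup T0) ≡.≡⟨ count-lookup T0 ⟨
        ∣ T0 ∣ ≡.∎
        where module ≡ = ≡-Reasoning

  module LargeDiameter (large : ¬ DiameterAtMost H′ 2) where

    member≢ : ∀ {s : Fin (suc m) → Bool} {c y} → s c ≡ true → s y ≡ false → c ≢ y
    member≢ sc sy refl with trans (sym sc) sy
    ... | ()

    -- If x is outside s but adjacent to all of s, then x is adjacent to
    -- every other leaf: the resolver of x and y is adjacent to x, so y is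
    -- within distance one of x.
    dominating-leaf : ∀ s → LeafResolving s → ∀ {x} → x ≢ v → s x ≡ false →
      (∀ c → s c ≡ true → adj H c x ≡ true) → ∀ y → y ≢ v → y ≢ x → adj H x y ≡ true
    dominating-leaf s resolving {x} x≢v sx adjacent y y≢v y≢x with resolving y _ y≢v x≢v y≢x
    ... | c , sc , inj₁ e = d₂≤1⇒adj (y≢x ∘ sym) (s≤s⁻¹ (begin
          suc (d₂ x y)      ≡⟨ cong (_+ d₂ x y) (d₂-adj (adjacent c sc)) ⟨
          d₂ c x + d₂ x y   ≡⟨ e ⟨
          d₂ c y            ≤⟨ d₂≤2 c y ⟩
          2                 ∎))
      where open ≤-Reasoning
    ... | c , sc , inj₂ e = trans (adjSym H x y) (d₂≤1⇒adj y≢x (begin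
          d₂ y x            ≤⟨ m≤n+m _ _ ⟩
          d₂ c y + d₂ y x   ≡⟨ e ⟨
          d₂ c x            ≡⟨ d₂-adj (adjacent c sc) ⟩
          1                 ∎))
      where open ≤-Reasoning

    root-pair : ∀ s → LeafResolving s → ∀ x → x ≢ v → ∃[ c ] (s c ≡ true × Resolves d₂ c v x)
    root-pair s resolving x x≢v with s v in sv | s x in sx
    ... | true  | _    = v , sv , resolves-self {d = d₂} x (d₂-refl v)
    ... | false | true = x , sx , resolves-swap {d = d₂} {x} {x} {v} (resolves-self {d = d₂} v (d₂-refl x))
    ... | false | false with any? (λ c → (s c ≟ᵇ true) ×-dec (adj H c x ≟ᵇ false))
    -- a member of s not adjacent to x sees x through the root
    ...   | yes (c , sc , c≁x) = c , sc , inj₂ (begin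
            d₂ c x          ≡⟨ d₂-nonadj (member≢ {s} sc sx) c≁x ⟩
            2               ≡⟨ cong₂ _+_ (leaf-root (member≢ {s} sc sv)) (root-leaf x≢v) ⟨
            d₂ c v + d₂ v x ∎)
      where open ≡-Reasoning
    -- otherwise x dominates H − v, which would then have diameter at most two
    ...   | no none = ⊥-elim (large (T′.universal⇒diameter≤2 a dominated))
      where
      adjacent : ∀ c → s c ≡ true → adj H c x ≡ true
      adjacent c sc with adj H c x in e
      ... | true  = refl
      ... | false = ⊥-elim (none (c , sc , e))
      a : Fin m
      a = proj₁ (leaf-of x≢v)
      a-is-x : punchIn v a ≡ x
      a-is-x = proj₂ (leaf-of x≢v)
      dominated : ∀ a′ → a′ ≢ a → adj H′ a a′ ≡ true
      dominated a′ a′≢a =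
        subst (λ z → adj H z (punchIn v a′) ≡ true) (sym a-is-x)
              (dominating-leaf s resolving x≢v sx adjacent (punchIn v a′) (punchInᵢ≢i v a′)
                               (a′≢a ∘ punchIn-injective v a′ a ∘ (λ e → trans e (sym a-is-x))))

    leaf-resolving⇒generates : ∀ s → LeafResolving s → Generates d₂ s
    leaf-resolving⇒generates s resolving b y b≢y with b ≟ᶠ v | y ≟ᶠ v
    ... | yes refl | yes refl = ⊥-elim (b≢y refl)
    ... | yes refl | no  y≢v  = root-pair s resolving y y≢v
    ... | no  b≢v  | yes refl with root-pair s resolving b b≢v
    ...   | c , sc , r = c , sc , resolves-swap {d = d₂} {c} {v} {b} r
    leaf-resolving⇒generates s resolving b y b≢y | no b≢v | no y≢v = resolving b y b≢v y≢v b≢y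

    minimum : ∀ k → IsStrongMetricDim H k → MinimumLeafResolving k
    minimum k ((T0 , gen0 , size0) , minimal) =
      (lookup T0 , (λ b y _ _ → to (generator⇔ H dH-distance T0) gen0 b y) ,
                   trans (sym (count-lookup T0)) size0) ,
      λ s resolving → ≤-trans (minimal (tabulate s) (generator s resolving)) (≤-reflexive (count-tabulate s))
      where
      generator : ∀ s → LeafResolving s → IsStrongMetricGenerator H (tabulate s)
      generator s resolving = from (generator⇔ H dH-distance (tabulate s))
        (generates-mono (λ c sc → trans (lookup∘tabulate s c) sc) (leaf-resolving⇒generates s resolving))

corollary17 : (r m : ℕ) (G : Graph r) (H : Graph (suc m)) (v : Fin (suc m)) →
    2 ≤ r → Connected G → 2 ≤ suc m → degree H v ≡ m →
    (HasDiameter (deleteVertex H v) 2 →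
      ∀ k → IsStrongMetricDim (deleteVertex H v) k →
        IsStrongMetricDim (rootedProduct G v H) ((r ∸ 1) * m + k))
    × (¬ DiameterAtMost (deleteVertex H v) 2 →
      ∀ k → IsStrongMetricDim H k →
        IsStrongMetricDim (rootedProduct G v H) ((r ∸ 1) * m + k))
corollary17 (suc zero)     m        G H v (s≤s ()) _ _ _
corollary17 (suc (suc r′)) zero     G H v _ _ (s≤s ()) _
corollary17 (suc (suc r′)) (suc m′) G H v _ connected _ deg =
  (λ diam k dim → dimension k (SmallDiameter.minimum (T′.diameter⇒diameter≤ diam) k dim)) ,
  (λ large k dim → dimension k (LargeDiameter.minimum large k dim))
  where
  universal : ∀ b → b ≢ v → adj H v b ≡ true
  universal = degree-universal H v deg
  open LeafResolvingSets H v universal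
  open ConeProduct G H v universal (proj₂ (connected-distance G connected)) using (MinimumLeafResolving; product-dimension)
  -- X has a second copy (suc zero) and H has a leaf (punchIn v zero).
  dimension : ∀ k → MinimumLeafResolving k → IsStrongMetricDim (rootedProduct G v H) (suc r′ * suc m′ + k)
  dimension = product-dimension zero (punchIn v zero) (punchInᵢ≢i v zero)
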